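{- Let $a_1/b_1,\ldots,a_k/b_k$ be $k$ rational numbers, with $a_i\in\mathbb{Z}$, $b_i$ positive integers and $\gcd(a_i,b_i)=1$ for $i=1,\ldots,k$. Then there exist a positive integer $n$ and a monic polynomial $f$ of degree $n$ with integer coefficients such that $$f\!\left(\frac{a_i}{b_i}\right)=\frac{1}{b_i^{\,n}},\qquad i=1,\ldots,k.$$ -}

module Defs where

open import Data.Nat as ℕ using (ℕ; NonZero)
open import Data.Integer as ℤ using (ℤ)
open import Data.Rational as ℚ using (ℚ; _+_; _*_)
open import Data.List using (List; []; _∷_; length)

infixr 8 _^_
_^_ : ℚ → ℕ → ℚ
x ^ ℕ.zero  = ℚ.1ℚ
x ^ ℕ.suc n = x * x ^ n

evalℤ[X] : List ℤ → ℚ → ℚ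
evalℤ[X] []       x = ℚ.0ℚ
evalℤ[X] (c ∷ cs) x = ℚ._/_ c 1 + x * evalℤ[X] cs x

-- The monic integer polynomial of degree n = length c:
--   X^n + c_{n-1} X^{n-1} + … + c₀,
-- encoded by its list c = [c₀, …, c_{n-1}] of non-leading coefficients.
-- This gives every monic polynomial of degree n with ℤ-coefficients exactly once.
evalMonic : List ℤ → ℚ → ℚ
evalMonic c x = evalℤ[X] c x + x ^ length c

-- Induction on the number of points. Suppose the monic f of degree n satisfies
-- bⱼⁿ f(aⱼ/bⱼ) = 1 at the old points and let A/B be the new one. The integer v = Bⁿ f(A/B)
-- is prime to B and to G = ∏ⱼ (bⱼA − aⱼB), so vᴹ ≡ 1 modulo G B for some M ≥ k + 1.
-- Then f′ = fᴹ + ∏ⱼ (bⱼX − aⱼ) · h has degree N = M n and still satisfies bⱼᴺ f′(aⱼ/bⱼ) = 1,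
-- while Bᴺ f′(A/B) = vᴹ + G B t, where t is any integer we like: Bézout for Aᵉ and Bᵉ gives an
-- h of degree e = N − k − 1 with Bᵉ h(A/B) = t. Taking t = −(vᴹ − 1)/(G B) finishes the step.
-- All values are tracked through the integers Bⁿ f(A/B), which are computed in ℚ.

module Submission where

open import Defs
open import Data.Nat as ℕ using (ℕ; NonZero; _>_)
open import Data.Integer as ℤ using (ℤ)
open import Data.Nat.Properties using (m^n≢0)
open import Data.Integer.GCD using (gcd)
open import Data.Rational as ℚ using (ℚ)
open import Data.Fin using (Fin)
open import Data.List using (List; length)
open import Data.Product using (Σ; _×_)
open import Relation.Binary.PropositionalEquality using (_≡_)

open import Data.Nat using (zero; suc; z≤n; s≤s)
open import Data.Integer using (+_; -[1+_]; 0ℤ; 1ℤ)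
open import Data.Integer.Divisibility.Signed
  using (_∣_; divides; ∣-refl; ∣-trans; m∣∣m∣; ∣m∣n⇒∣m+n; ∣n⇒∣m*n; ∣m⇒∣m*n)
import Data.Integer.DivMod as ℤ
import Data.Integer.Properties as ℤP
import Data.Nat.Properties as ℕP
open import Data.Nat.Coprimality using (gcd≡1⇒coprime; coprime-Bézout)
import Data.Nat.GCD
open import Data.Rational.Unnormalised as ℚᵘ using (mkℚᵘ; *≡*) renaming (_≃_ to _≃ᵘ_)
import Data.Rational.Unnormalised.Properties as ℚᵘP
import Data.Rational.Properties as ℚP
open import Data.Fin using (toℕ; fromℕ<) renaming (zero to fzero; suc to fsuc)
import Data.Fin.Properties as FinP
open import Data.List using ([]; _∷_; map)
import Data.List.Properties as ListP
open import Data.Product using (_,_; ∃; ∃₂; map₂)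
open import Data.Maybe using (Maybe)
open import Relation.Nullary.Decidable using (dec⇒maybe)
open import Function using (_∘_)
open import Level using (0ℓ)
open import Relation.Binary.PropositionalEquality
  using (refl; sym; trans; cong; cong₂; subst; module ≡-Reasoning)
open import Algebra.Properties.Group ℚP.+-0-group using (inverseˡ-unique)
open import Tactic.RingSolver using (solve-∀)
open import Tactic.RingSolver.Core.AlmostCommutativeRing
  using (AlmostCommutativeRing; fromCommutativeRing)
open import Data.Integer.Tactic.RingSolver using () renaming (ring to ℤ-ring)

module ℕBézout = Data.Nat.GCD.Bézout.Identity

ℚ-ring : AlmostCommutativeRing 0ℓ 0ℓ
ℚ-ring = fromCommutativeRing ℚP.+-*-commutativeRing is-zero?
  where
  is-zero? : ∀ x → Maybe (ℚ.0ℚ ≡ x)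
  is-zero? x = dec⇒maybe (ℚ.0ℚ ℚP.≟ x)

fromℤ : ℤ → ℚ
fromℤ z = z ℚ./ 1

toℚᵘ-fromℤ : ∀ z → ℚ.toℚᵘ (fromℤ z) ≃ᵘ mkℚᵘ z 0
toℚᵘ-fromℤ z = ℚP.toℚᵘ-fromℚᵘ (mkℚᵘ z 0)

fromℤ-homo-+ : ∀ x y → fromℤ (x ℤ.+ y) ≡ fromℤ x ℚ.+ fromℤ y
fromℤ-homo-+ x y = ℚP.toℚᵘ-injective (begin
  ℚ.toℚᵘ (fromℤ (x ℤ.+ y))                 ≈⟨ toℚᵘ-fromℤ (x ℤ.+ y) ⟩
  mkℚᵘ (x ℤ.+ y) 0                         ≈⟨ *≡* (identity x y) ⟩
  mkℚᵘ x 0 ℚᵘ.+ mkℚᵘ y 0                   ≈⟨ ℚᵘP.+-cong (toℚᵘ-fromℤ x) (toℚᵘ-fromℤ y) ⟨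
  ℚ.toℚᵘ (fromℤ x) ℚᵘ.+ ℚ.toℚᵘ (fromℤ y)   ≈⟨ ℚP.toℚᵘ-homo-+ (fromℤ x) (fromℤ y) ⟨
  ℚ.toℚᵘ (fromℤ x ℚ.+ fromℤ y)             ∎)
  where
  open ℚᵘP.≃-Reasoning
  identity : ∀ x y → (x ℤ.+ y) ℤ.* 1ℤ ≡ (x ℤ.* 1ℤ ℤ.+ y ℤ.* 1ℤ) ℤ.* 1ℤ
  identity = solve-∀ ℤ-ring

fromℤ-homo-* : ∀ x y → fromℤ (x ℤ.* y) ≡ fromℤ x ℚ.* fromℤ y
fromℤ-homo-* x y = ℚP.toℚᵘ-injective (begin
  ℚ.toℚᵘ (fromℤ (x ℤ.* y))                 ≈⟨ toℚᵘ-fromℤ (x ℤ.* y) ⟩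
  mkℚᵘ (x ℤ.* y) 0                         ≈⟨ ℚᵘP.*-cong (toℚᵘ-fromℤ x) (toℚᵘ-fromℤ y) ⟨
  ℚ.toℚᵘ (fromℤ x) ℚᵘ.* ℚ.toℚᵘ (fromℤ y)   ≈⟨ ℚP.toℚᵘ-homo-* (fromℤ x) (fromℤ y) ⟨
  ℚ.toℚᵘ (fromℤ x ℚ.* fromℤ y)             ∎)
  where open ℚᵘP.≃-Reasoning

fromℤ-homo‿- : ∀ x → fromℤ (ℤ.- x) ≡ ℚ.- fromℤ x
fromℤ-homo‿- x = inverseˡ-unique (fromℤ (ℤ.- x)) (fromℤ x)
  (trans (sym (fromℤ-homo-+ (ℤ.- x) x)) (cong fromℤ (ℤP.+-inverseˡ x)))

fromℤ-homo-− : ∀ x y → fromℤ (x ℤ.- y) ≡ fromℤ x ℚ.- fromℤ y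
fromℤ-homo-− x y = trans (fromℤ-homo-+ x (ℤ.- y)) (cong (fromℤ x ℚ.+_) (fromℤ-homo‿- y))

fromℤ-homo-^ : ∀ x n → fromℤ (x ℤ.^ n) ≡ fromℤ x ^ n
fromℤ-homo-^ x zero    = refl
fromℤ-homo-^ x (suc n) = trans (fromℤ-homo-* x (x ℤ.^ n)) (cong (fromℤ x ℚ.*_) (fromℤ-homo-^ x n))

fromℤ-+-^ : ∀ b n → fromℤ (+ (b ℕ.^ n)) ≡ fromℤ (+ b) ^ n
fromℤ-+-^ b zero    = refl
fromℤ-+-^ b (suc n) = begin
  fromℤ (+ (b ℕ.* b ℕ.^ n))         ≡⟨ cong fromℤ (ℤP.pos-* b (b ℕ.^ n)) ⟩
  fromℤ (+ b ℤ.* + (b ℕ.^ n))       ≡⟨ fromℤ-homo-* (+ b) (+ (b ℕ.^ n)) ⟩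
  fromℤ (+ b) ℚ.* fromℤ (+ (b ℕ.^ n)) ≡⟨ cong (fromℤ (+ b) ℚ.*_) (fromℤ-+-^ b n) ⟩
  fromℤ (+ b) ^ suc n               ∎
  where open ≡-Reasoning

fromℤ-injective : ∀ {x y} → fromℤ x ≡ fromℤ y → x ≡ y
fromℤ-injective {x} {y} eq = numerators-≡
  (ℚᵘP.≃-trans (ℚᵘP.≃-sym (toℚᵘ-fromℤ x)) (ℚᵘP.≃-trans (ℚP.toℚᵘ-cong eq) (toℚᵘ-fromℤ y)))
  where
  numerators-≡ : mkℚᵘ x 0 ≃ᵘ mkℚᵘ y 0 → x ≡ y
  numerators-≡ (*≡* x*1≡y*1) = trans (sym (ℤP.*-identityʳ x)) (trans x*1≡y*1 (ℤP.*-identityʳ y))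

fromℤ-*-/ : ∀ i d .{{_ : NonZero d}} → fromℤ (+ d) ℚ.* (i ℚ./ d) ≡ fromℤ i
fromℤ-*-/ i d@(suc d-1) = ℚP.toℚᵘ-injective (begin
  ℚ.toℚᵘ (fromℤ (+ d) ℚ.* (i ℚ./ d))          ≈⟨ ℚP.toℚᵘ-homo-* (fromℤ (+ d)) (i ℚ./ d) ⟩
  ℚ.toℚᵘ (fromℤ (+ d)) ℚᵘ.* ℚ.toℚᵘ (i ℚ./ d)  ≈⟨ ℚᵘP.*-cong (toℚᵘ-fromℤ (+ d)) (ℚP.toℚᵘ-fromℚᵘ (mkℚᵘ i d-1)) ⟩
  mkℚᵘ (+ d) 0 ℚᵘ.* mkℚᵘ i d-1                ≈⟨ *≡* (identity (+ d) i) ⟩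
  mkℚᵘ i 0                                    ≈⟨ toℚᵘ-fromℤ i ⟨
  ℚ.toℚᵘ (fromℤ i)                            ∎)
  where
  open ℚᵘP.≃-Reasoning
  identity : ∀ x i → (x ℤ.* i) ℤ.* 1ℤ ≡ i ℤ.* (1ℤ ℤ.* x)
  identity = solve-∀ ℤ-ring

fromℤ-*≡1⇒≡1/ : ∀ d .{{_ : NonZero d}} x → fromℤ (+ d) ℚ.* x ≡ ℚ.1ℚ → x ≡ 1ℤ ℚ./ d
fromℤ-*≡1⇒≡1/ d x dx≡1 = begin
  x                                   ≡⟨ ℚP.*-identityʳ x ⟨
  x ℚ.* ℚ.1ℚ                          ≡⟨ cong (x ℚ.*_) (fromℤ-*-/ 1ℤ d) ⟨
  x ℚ.* (fromℤ (+ d) ℚ.* (1ℤ ℚ./ d))  ≡⟨ rearrange x (fromℤ (+ d)) (1ℤ ℚ./ d) ⟩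
  (fromℤ (+ d) ℚ.* x) ℚ.* (1ℤ ℚ./ d)  ≡⟨ cong (ℚ._* (1ℤ ℚ./ d)) dx≡1 ⟩
  ℚ.1ℚ ℚ.* (1ℤ ℚ./ d)                 ≡⟨ ℚP.*-identityˡ (1ℤ ℚ./ d) ⟩
  1ℤ ℚ./ d                            ∎
  where
  open ≡-Reasoning
  rearrange : ∀ x y z → x ℚ.* (y ℚ.* z) ≡ (y ℚ.* x) ℚ.* z
  rearrange = solve-∀ ℚ-ring

^-distribˡ-+-* : ∀ x m n → x ^ (m ℕ.+ n) ≡ x ^ m ℚ.* x ^ n
^-distribˡ-+-* x zero    n = sym (ℚP.*-identityˡ (x ^ n))
^-distribˡ-+-* x (suc m) n =
  trans (cong (x ℚ.*_) (^-distribˡ-+-* x m n)) (sym (ℚP.*-assoc x (x ^ m) (x ^ n)))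

^-*-assoc : ∀ x m n → (x ^ m) ^ n ≡ x ^ (m ℕ.* n)
^-*-assoc x m zero    = cong (x ^_) (sym (ℕP.*-zeroʳ m))
^-*-assoc x m (suc n) = begin
  x ^ m ℚ.* (x ^ m) ^ n      ≡⟨ cong (x ^ m ℚ.*_) (^-*-assoc x m n) ⟩
  x ^ m ℚ.* x ^ (m ℕ.* n)    ≡⟨ ^-distribˡ-+-* x m (m ℕ.* n) ⟨
  x ^ (m ℕ.+ m ℕ.* n)        ≡⟨ cong (x ^_) (ℕP.*-suc m n) ⟨
  x ^ (m ℕ.* suc n)          ∎
  where open ≡-Reasoning

^-distribʳ-* : ∀ x y n → (x ℚ.* y) ^ n ≡ x ^ n ℚ.* y ^ n
^-distribʳ-* x y zero    = refl
^-distribʳ-* x y (suc n) =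
  trans (cong ((x ℚ.* y) ℚ.*_) (^-distribʳ-* x y n)) (interchange x y (x ^ n) (y ^ n))
  where
  interchange : ∀ x y u v → (x ℚ.* y) ℚ.* (u ℚ.* v) ≡ (x ℚ.* u) ℚ.* (y ℚ.* v)
  interchange = solve-∀ ℚ-ring

-- Arithmetic on coefficient lists

⟦_⟧ : List ℤ → ℚ → ℚ
⟦_⟧ = evalℤ[X]

infixl 6 _⊕_
_⊕_ : List ℤ → List ℤ → List ℤ
[]       ⊕ q        = q
(c ∷ cs) ⊕ []       = c ∷ cs
(c ∷ cs) ⊕ (d ∷ ds) = (c ℤ.+ d) ∷ (cs ⊕ ds)

eval-⊕ : ∀ p q x → ⟦ p ⊕ q ⟧ x ≡ ⟦ p ⟧ x ℚ.+ ⟦ q ⟧ x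
eval-⊕ []       q        x = sym (ℚP.+-identityˡ (⟦ q ⟧ x))
eval-⊕ (c ∷ cs) []       x = sym (ℚP.+-identityʳ (⟦ c ∷ cs ⟧ x))
eval-⊕ (c ∷ cs) (d ∷ ds) x =
  trans (cong₂ (λ u v → u ℚ.+ x ℚ.* v) (fromℤ-homo-+ c d) (eval-⊕ cs ds x))
        (regroup (fromℤ c) (fromℤ d) x (⟦ cs ⟧ x) (⟦ ds ⟧ x))
  where
  regroup : ∀ c d x u v → (c ℚ.+ d) ℚ.+ x ℚ.* (u ℚ.+ v) ≡ (c ℚ.+ x ℚ.* u) ℚ.+ (d ℚ.+ x ℚ.* v)
  regroup = solve-∀ ℚ-ring

length-⊕ : ∀ p q → length (p ⊕ q) ≡ length p ℕ.⊔ length q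
length-⊕ []       q        = refl
length-⊕ (c ∷ cs) []       = refl
length-⊕ (c ∷ cs) (d ∷ ds) = cong suc (length-⊕ cs ds)

scale : ℤ → List ℤ → List ℤ
scale s = map (s ℤ.*_)

eval-scale : ∀ s p x → ⟦ scale s p ⟧ x ≡ fromℤ s ℚ.* ⟦ p ⟧ x
eval-scale s []       x = sym (ℚP.*-zeroʳ (fromℤ s))
eval-scale s (c ∷ cs) x =
  trans (cong₂ (λ u v → u ℚ.+ x ℚ.* v) (fromℤ-homo-* s c) (eval-scale s cs x))
        (factor (fromℤ s) (fromℤ c) x (⟦ cs ⟧ x))
  where
  factor : ∀ s c x u → s ℚ.* c ℚ.+ x ℚ.* (s ℚ.* u) ≡ s ℚ.* (c ℚ.+ x ℚ.* u)
  factor = solve-∀ ℚ-ring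

length-scale : ∀ s p → length (scale s p) ≡ length p
length-scale s = ListP.length-map (s ℤ.*_)

shift : ℕ → List ℤ → List ℤ
shift zero    p = p
shift (suc e) p = 0ℤ ∷ shift e p

eval-shift : ∀ e p x → ⟦ shift e p ⟧ x ≡ x ^ e ℚ.* ⟦ p ⟧ x
eval-shift zero    p x = sym (ℚP.*-identityˡ (⟦ p ⟧ x))
eval-shift (suc e) p x =
  trans (cong (λ v → ℚ.0ℚ ℚ.+ x ℚ.* v) (eval-shift e p x)) (reassoc x (x ^ e) (⟦ p ⟧ x))
  where
  reassoc : ∀ x u v → ℚ.0ℚ ℚ.+ x ℚ.* (u ℚ.* v) ≡ (x ℚ.* u) ℚ.* v
  reassoc = solve-∀ ℚ-ring

length-shift : ∀ e p → length (shift e p) ≡ e ℕ.+ length p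
length-shift zero    p = refl
length-shift (suc e) p = cong suc (length-shift e p)

infixl 7 _⊗_
_⊗_ : List ℤ → List ℤ → List ℤ
[]       ⊗ q = []
(c ∷ cs) ⊗ q = scale c q ⊕ (0ℤ ∷ cs ⊗ q)

eval-⊗ : ∀ p q x → ⟦ p ⊗ q ⟧ x ≡ ⟦ p ⟧ x ℚ.* ⟦ q ⟧ x
eval-⊗ []       q x = sym (ℚP.*-zeroˡ (⟦ q ⟧ x))
eval-⊗ (c ∷ cs) q x = begin
  ⟦ scale c q ⊕ (0ℤ ∷ cs ⊗ q) ⟧ x
    ≡⟨ eval-⊕ (scale c q) (0ℤ ∷ cs ⊗ q) x ⟩
  ⟦ scale c q ⟧ x ℚ.+ (ℚ.0ℚ ℚ.+ x ℚ.* ⟦ cs ⊗ q ⟧ x)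
    ≡⟨ cong₂ (λ u v → u ℚ.+ (ℚ.0ℚ ℚ.+ x ℚ.* v)) (eval-scale c q x) (eval-⊗ cs q x) ⟩
  fromℤ c ℚ.* ⟦ q ⟧ x ℚ.+ (ℚ.0ℚ ℚ.+ x ℚ.* (⟦ cs ⟧ x ℚ.* ⟦ q ⟧ x))
    ≡⟨ factor (fromℤ c) x (⟦ cs ⟧ x) (⟦ q ⟧ x) ⟩
  (fromℤ c ℚ.+ x ℚ.* ⟦ cs ⟧ x) ℚ.* ⟦ q ⟧ x
    ∎
  where
  open ≡-Reasoning
  factor : ∀ c x u v → c ℚ.* v ℚ.+ (ℚ.0ℚ ℚ.+ x ℚ.* (u ℚ.* v)) ≡ (c ℚ.+ x ℚ.* u) ℚ.* v
  factor = solve-∀ ℚ-ring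

length-⊗ : ∀ p q → length (p ⊗ q) ℕ.≤ length p ℕ.+ length q
length-⊗ []       q = z≤n
length-⊗ (c ∷ cs) q = begin
  length (scale c q ⊕ (0ℤ ∷ cs ⊗ q))             ≡⟨ length-⊕ (scale c q) (0ℤ ∷ cs ⊗ q) ⟩
  length (scale c q) ℕ.⊔ suc (length (cs ⊗ q))   ≡⟨ cong (ℕ._⊔ suc (length (cs ⊗ q))) (length-scale c q) ⟩
  length q ℕ.⊔ suc (length (cs ⊗ q))             ≤⟨ ℕP.⊔-lub (ℕP.m≤n+m (length q) (suc (length cs)))
                                                                (s≤s (length-⊗ cs q)) ⟩
  suc (length cs) ℕ.+ length q                   ∎
  where open ℕP.≤-Reasoning

evalMonic-∷ : ∀ c cs x → evalMonic (c ∷ cs) x ≡ fromℤ c ℚ.+ x ℚ.* evalMonic cs x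
evalMonic-∷ c cs x = horner (fromℤ c) x (⟦ cs ⟧ x) (x ^ length cs)
  where
  horner : ∀ c x u v → (c ℚ.+ x ℚ.* u) ℚ.+ x ℚ.* v ≡ c ℚ.+ x ℚ.* (u ℚ.+ v)
  horner = solve-∀ ℚ-ring

-- (Xⁿ¹ + c₁)(Xⁿ² + c₂) = c₁c₂ + Xⁿ²c₁ + Xⁿ¹c₂ + Xⁿ¹⁺ⁿ²
infixl 7 _⊗ₘ_
_⊗ₘ_ : List ℤ → List ℤ → List ℤ
c₁ ⊗ₘ c₂ = c₁ ⊗ c₂ ⊕ (shift (length c₂) c₁ ⊕ shift (length c₁) c₂)

length-⊗ₘ : ∀ c₁ c₂ → length (c₁ ⊗ₘ c₂) ≡ length c₁ ℕ.+ length c₂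
length-⊗ₘ c₁ c₂ = begin
  length (c₁ ⊗ₘ c₂)
    ≡⟨ length-⊕ (c₁ ⊗ c₂) _ ⟩
  length (c₁ ⊗ c₂) ℕ.⊔ length (shift n₂ c₁ ⊕ shift n₁ c₂)
    ≡⟨ cong (length (c₁ ⊗ c₂) ℕ.⊔_) (length-⊕ (shift n₂ c₁) (shift n₁ c₂)) ⟩
  length (c₁ ⊗ c₂) ℕ.⊔ (length (shift n₂ c₁) ℕ.⊔ length (shift n₁ c₂))
    ≡⟨ cong₂ (λ u v → length (c₁ ⊗ c₂) ℕ.⊔ (u ℕ.⊔ v))
             (trans (length-shift n₂ c₁) (ℕP.+-comm n₂ n₁)) (length-shift n₁ c₂) ⟩
  length (c₁ ⊗ c₂) ℕ.⊔ ((n₁ ℕ.+ n₂) ℕ.⊔ (n₁ ℕ.+ n₂))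
    ≡⟨ cong (length (c₁ ⊗ c₂) ℕ.⊔_) (ℕP.⊔-idem (n₁ ℕ.+ n₂)) ⟩
  length (c₁ ⊗ c₂) ℕ.⊔ (n₁ ℕ.+ n₂)
    ≡⟨ ℕP.m≤n⇒m⊔n≡n (length-⊗ c₁ c₂) ⟩
  n₁ ℕ.+ n₂
    ∎
  where
  open ≡-Reasoning
  n₁ = length c₁
  n₂ = length c₂

evalMonic-⊗ₘ : ∀ c₁ c₂ x → evalMonic (c₁ ⊗ₘ c₂) x ≡ evalMonic c₁ x ℚ.* evalMonic c₂ x
evalMonic-⊗ₘ c₁ c₂ x = begin
  ⟦ c₁ ⊗ₘ c₂ ⟧ x ℚ.+ x ^ length (c₁ ⊗ₘ c₂)
    ≡⟨ cong₂ ℚ._+_ eval-lower (trans (cong (x ^_) (length-⊗ₘ c₁ c₂)) (^-distribˡ-+-* x n₁ n₂)) ⟩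
  (u₁ ℚ.* u₂ ℚ.+ (x ^ n₂ ℚ.* u₁ ℚ.+ x ^ n₁ ℚ.* u₂)) ℚ.+ x ^ n₁ ℚ.* x ^ n₂
    ≡⟨ expand u₁ u₂ (x ^ n₁) (x ^ n₂) ⟩
  (u₁ ℚ.+ x ^ n₁) ℚ.* (u₂ ℚ.+ x ^ n₂)
    ∎
  where
  open ≡-Reasoning
  n₁ = length c₁
  n₂ = length c₂
  u₁ = ⟦ c₁ ⟧ x
  u₂ = ⟦ c₂ ⟧ x
  eval-lower : ⟦ c₁ ⊗ₘ c₂ ⟧ x ≡ u₁ ℚ.* u₂ ℚ.+ (x ^ n₂ ℚ.* u₁ ℚ.+ x ^ n₁ ℚ.* u₂)
  eval-lower = trans (eval-⊕ (c₁ ⊗ c₂) _ x) (cong₂ ℚ._+_ (eval-⊗ c₁ c₂ x)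
    (trans (eval-⊕ (shift n₂ c₁) (shift n₁ c₂) x) (cong₂ ℚ._+_ (eval-shift n₂ c₁ x) (eval-shift n₁ c₂ x))))
  expand : ∀ u₁ u₂ y₁ y₂ → (u₁ ℚ.* u₂ ℚ.+ (y₂ ℚ.* u₁ ℚ.+ y₁ ℚ.* u₂)) ℚ.+ y₁ ℚ.* y₂
                          ≡ (u₁ ℚ.+ y₁) ℚ.* (u₂ ℚ.+ y₂)
  expand = solve-∀ ℚ-ring

infixr 8 _^ₘ_
_^ₘ_ : List ℤ → ℕ → List ℤ
c ^ₘ zero  = []
c ^ₘ suc M = c ⊗ₘ c ^ₘ M

length-^ₘ : ∀ c M → length (c ^ₘ M) ≡ M ℕ.* length c
length-^ₘ c zero    = refl
length-^ₘ c (suc M) = trans (length-⊗ₘ c (c ^ₘ M)) (cong (length c ℕ.+_) (length-^ₘ c M))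

evalMonic-^ₘ : ∀ c M x → evalMonic (c ^ₘ M) x ≡ evalMonic c x ^ M
evalMonic-^ₘ c zero    x = refl
evalMonic-^ₘ c (suc M) x =
  trans (evalMonic-⊗ₘ c (c ^ₘ M) x) (cong (evalMonic c x ℚ.*_) (evalMonic-^ₘ c M x))

length-⊕-≤ : ∀ c q → length q ℕ.≤ length c → length (c ⊕ q) ≡ length c
length-⊕-≤ c q q≤c = trans (length-⊕ c q) (ℕP.m≥n⇒m⊔n≡m q≤c)

evalMonic-⊕-≤ : ∀ c q x → length q ℕ.≤ length c → evalMonic (c ⊕ q) x ≡ evalMonic c x ℚ.+ ⟦ q ⟧ x
evalMonic-⊕-≤ c q x q≤c =
  trans (cong₂ ℚ._+_ (eval-⊕ c q x) (cong (x ^_) (length-⊕-≤ c q q≤c)))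
        (swap (⟦ c ⟧ x) (⟦ q ⟧ x) (x ^ length c))
  where
  swap : ∀ u v w → (u ℚ.+ v) ℚ.+ w ≡ (u ℚ.+ w) ℚ.+ v
  swap = solve-∀ ℚ-ring

-- Coprimality in ℤ

record Bézout (x y : ℤ) : Set where
  constructor bézout
  field
    u w      : ℤ
    identity : u ℤ.* x ℤ.+ w ℤ.* y ≡ 1ℤ

bézout-sym : ∀ {x y} → Bézout x y → Bézout y x
bézout-sym {x} {y} (bézout u w eq) = bézout w u (trans (ℤP.+-comm (w ℤ.* y) (u ℤ.* x)) eq)

bézout-1ʳ : ∀ x → Bézout x 1ℤ
bézout-1ʳ x = bézout 0ℤ 1ℤ (identity x)
  where
  identity : ∀ x → 0ℤ ℤ.* x ℤ.+ 1ℤ ℤ.* 1ℤ ≡ 1ℤ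
  identity = solve-∀ ℤ-ring

bézout-*ʳ : ∀ {x y z} → Bézout x y → Bézout x z → Bézout x (y ℤ.* z)
bézout-*ʳ {x} {y} {z} (bézout u₁ w₁ eq₁) (bézout u₂ w₂ eq₂) =
  bézout (u₁ ℤ.* u₂ ℤ.* x ℤ.+ u₁ ℤ.* w₂ ℤ.* z ℤ.+ w₁ ℤ.* y ℤ.* u₂) (w₁ ℤ.* w₂)
         (trans (expand x y z u₁ w₁ u₂ w₂) (cong₂ ℤ._*_ eq₁ eq₂))
  where
  expand : ∀ x y z u₁ w₁ u₂ w₂ →
    (u₁ ℤ.* u₂ ℤ.* x ℤ.+ u₁ ℤ.* w₂ ℤ.* z ℤ.+ w₁ ℤ.* y ℤ.* u₂) ℤ.* x ℤ.+ (w₁ ℤ.* w₂) ℤ.* (y ℤ.* z)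
      ≡ (u₁ ℤ.* x ℤ.+ w₁ ℤ.* y) ℤ.* (u₂ ℤ.* x ℤ.+ w₂ ℤ.* z)
  expand = solve-∀ ℤ-ring

bézout-*ˡ : ∀ {x y z} → Bézout x z → Bézout y z → Bézout (x ℤ.* y) z
bézout-*ˡ bx by = bézout-sym (bézout-*ʳ (bézout-sym bx) (bézout-sym by))

bézout-^ʳ : ∀ {x y} n → Bézout x y → Bézout x (y ℤ.^ n)
bézout-^ʳ {x} zero    _  = bézout-1ʳ x
bézout-^ʳ     (suc n) bz = bézout-*ʳ bz (bézout-^ʳ n bz)

bézout-^ˡ : ∀ {x y} n → Bézout x y → Bézout (x ℤ.^ n) y
bézout-^ˡ n bz = bézout-sym (bézout-^ʳ n (bézout-sym bz))

bézout-neg : ∀ {x y} → Bézout x y → Bézout (ℤ.- x) y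
bézout-neg {x} {y} (bézout u w eq) = bézout (ℤ.- u) w (trans (identity u x w y) eq)
  where
  identity : ∀ u x w y → ℤ.- u ℤ.* ℤ.- x ℤ.+ w ℤ.* y ≡ u ℤ.* x ℤ.+ w ℤ.* y
  identity = solve-∀ ℤ-ring

bézout-+-∣ : ∀ {x y t} → y ∣ t → Bézout x y → Bézout (t ℤ.+ x) y
bézout-+-∣ {x} {y} (divides s refl) (bézout u w eq) =
  bézout u (w ℤ.- u ℤ.* s) (trans (identity x y s u w) eq)
  where
  identity : ∀ x y s u w → u ℤ.* (s ℤ.* y ℤ.+ x) ℤ.+ (w ℤ.- u ℤ.* s) ℤ.* y ≡ u ℤ.* x ℤ.+ w ℤ.* y
  identity = solve-∀ ℤ-ring

-- B lies in the ideal (v, D), so (v, B) = (1) forces (v, D) = (1).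
bézout-transfer : ∀ {v B D} β → D ∣ β ℤ.* v ℤ.- B → Bézout v B → Bézout v D
bézout-transfer {v} {B} {D} β (divides s eq) (bézout u w eq′) =
  bézout (u ℤ.+ w ℤ.* β) (ℤ.- (w ℤ.* s)) (begin
    (u ℤ.+ w ℤ.* β) ℤ.* v ℤ.+ ℤ.- (w ℤ.* s) ℤ.* D       ≡⟨ expand u w β v B s D ⟩
    (u ℤ.* v ℤ.+ w ℤ.* B) ℤ.+ w ℤ.* ((β ℤ.* v ℤ.- B) ℤ.- s ℤ.* D)
      ≡⟨ cong (λ z → (u ℤ.* v ℤ.+ w ℤ.* B) ℤ.+ w ℤ.* (z ℤ.- s ℤ.* D)) eq ⟩
    (u ℤ.* v ℤ.+ w ℤ.* B) ℤ.+ w ℤ.* (s ℤ.* D ℤ.- s ℤ.* D) ≡⟨ cancel (u ℤ.* v ℤ.+ w ℤ.* B) w (s ℤ.* D) ⟩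
    u ℤ.* v ℤ.+ w ℤ.* B                                  ≡⟨ eq′ ⟩
    1ℤ                                                   ∎)
  where
  open ≡-Reasoning
  expand : ∀ u w β v B s D → (u ℤ.+ w ℤ.* β) ℤ.* v ℤ.+ ℤ.- (w ℤ.* s) ℤ.* D
                            ≡ (u ℤ.* v ℤ.+ w ℤ.* B) ℤ.+ w ℤ.* ((β ℤ.* v ℤ.- B) ℤ.- s ℤ.* D)
  expand = solve-∀ ℤ-ring
  cancel : ∀ z w y → z ℤ.+ w ℤ.* (y ℤ.- y) ≡ z
  cancel = solve-∀ ℤ-ring

bézout-cancel : ∀ {x y N} → Bézout x N → N ∣ x ℤ.* y → N ∣ y
bézout-cancel {x} {y} {N} (bézout u w eq) (divides s xy≡sN) = divides (u ℤ.* s ℤ.+ w ℤ.* y) (begin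
  y                                   ≡⟨ ℤP.*-identityˡ y ⟨
  1ℤ ℤ.* y                            ≡⟨ cong (ℤ._* y) eq ⟨
  (u ℤ.* x ℤ.+ w ℤ.* N) ℤ.* y         ≡⟨ expand u x w N y ⟩
  u ℤ.* (x ℤ.* y) ℤ.+ w ℤ.* y ℤ.* N   ≡⟨ cong (λ z → u ℤ.* z ℤ.+ w ℤ.* y ℤ.* N) xy≡sN ⟩
  u ℤ.* (s ℤ.* N) ℤ.+ w ℤ.* y ℤ.* N   ≡⟨ collect u s N (w ℤ.* y) ⟩
  (u ℤ.* s ℤ.+ w ℤ.* y) ℤ.* N         ∎)
  where
  open ≡-Reasoning
  expand : ∀ u x w N y → (u ℤ.* x ℤ.+ w ℤ.* N) ℤ.* y ≡ u ℤ.* (x ℤ.* y) ℤ.+ w ℤ.* y ℤ.* N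
  expand = solve-∀ ℤ-ring
  collect : ∀ u s N t → u ℤ.* (s ℤ.* N) ℤ.+ t ℤ.* N ≡ (u ℤ.* s ℤ.+ t) ℤ.* N
  collect = solve-∀ ℤ-ring

bézout[v,0]⇒v*v≡1 : ∀ {v} → Bézout v 0ℤ → v ℤ.* v ≡ 1ℤ
bézout[v,0]⇒v*v≡1 {v} (bézout u w eq) = unit v (ℕP.m*n≡1⇒n≡1 ℤ.∣ u ∣ ℤ.∣ v ∣ ∣u∣*∣v∣≡1)
  where
  uv≡1 : u ℤ.* v ≡ 1ℤ
  uv≡1 = trans (sym (trans (cong (λ z → u ℤ.* v ℤ.+ z) (ℤP.*-zeroʳ w)) (ℤP.+-identityʳ (u ℤ.* v)))) eq
  ∣u∣*∣v∣≡1 : ℤ.∣ u ∣ ℕ.* ℤ.∣ v ∣ ≡ 1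
  ∣u∣*∣v∣≡1 = trans (sym (ℤP.abs-* u v)) (cong ℤ.∣_∣ uv≡1)
  unit : ∀ v → ℤ.∣ v ∣ ≡ 1 → v ℤ.* v ≡ 1ℤ
  unit (+ .1)      refl = refl
  unit -[1+ .0 ]   refl = refl

bézout-ℕ : ∀ {m n} → ℕBézout.Identity 1 m n → Bézout (+ m) (+ n)
bézout-ℕ {m} {n} (ℕBézout.+- x y eq) = bézout (+ x) (ℤ.- + y) (begin
  + x ℤ.* + m ℤ.+ ℤ.- + y ℤ.* + n          ≡⟨ cong (λ z → z ℤ.+ ℤ.- + y ℤ.* + n) xm≡1+yn ⟩
  (1ℤ ℤ.+ + y ℤ.* + n) ℤ.+ ℤ.- + y ℤ.* + n ≡⟨ cancel (+ y) (+ n) ⟩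
  1ℤ                                       ∎)
  where
  open ≡-Reasoning
  xm≡1+yn : + x ℤ.* + m ≡ 1ℤ ℤ.+ + y ℤ.* + n
  xm≡1+yn = trans (sym (ℤP.pos-* x m))
    (trans (cong +_ (sym eq)) (trans (ℤP.pos-+ 1 (y ℕ.* n)) (cong (λ z → 1ℤ ℤ.+ z) (ℤP.pos-* y n))))
  cancel : ∀ y n → (1ℤ ℤ.+ y ℤ.* n) ℤ.+ ℤ.- y ℤ.* n ≡ 1ℤ
  cancel = solve-∀ ℤ-ring
bézout-ℕ (ℕBézout.-+ x y eq) = bézout-sym (bézout-ℕ (ℕBézout.+- y x eq))

gcd≡1⇒bézout : ∀ a b → gcd a (+ b) ≡ 1ℤ → Bézout a (+ b)
gcd≡1⇒bézout (+ m)      b eq = bézout-ℕ (coprime-Bézout (gcd≡1⇒coprime (ℤP.+-injective eq)))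
gcd≡1⇒bézout -[1+ m ]   b eq = bézout-neg (bézout-ℕ (coprime-Bézout (gcd≡1⇒coprime (ℤP.+-injective eq))))

∣x-1⇒∣x^n-1 : ∀ {N x} n → N ∣ x ℤ.- 1ℤ → N ∣ x ℤ.^ n ℤ.- 1ℤ
∣x-1⇒∣x^n-1 {N}     zero    _     = divides 0ℤ (identity N)
  where
  identity : ∀ N → 1ℤ ℤ.- 1ℤ ≡ 0ℤ ℤ.* N
  identity = solve-∀ ℤ-ring
∣x-1⇒∣x^n-1 {N} {x} (suc n) N∣x-1 =
  subst (N ∣_) (split x (x ℤ.^ n)) (∣m∣n⇒∣m+n (∣n⇒∣m*n x (∣x-1⇒∣x^n-1 n N∣x-1)) N∣x-1)
  where
  split : ∀ x y → x ℤ.* (y ℤ.- 1ℤ) ℤ.+ (x ℤ.- 1ℤ) ≡ x ℤ.* y ℤ.- 1ℤ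
  split = solve-∀ ℤ-ring

%ℕ-≡⇒∣- : ∀ x y d .{{_ : NonZero d}} → x ℤ.%ℕ d ≡ y ℤ.%ℕ d → + d ∣ x ℤ.- y
%ℕ-≡⇒∣- x y d eq = divides (x ℤ./ℕ d ℤ.- y ℤ./ℕ d) (begin
  x ℤ.- y
    ≡⟨ cong₂ ℤ._-_ (ℤ.a≡a%ℕn+[a/ℕn]*n x d)
         (trans (ℤ.a≡a%ℕn+[a/ℕn]*n y d) (cong (λ r → + r ℤ.+ y ℤ./ℕ d ℤ.* + d) (sym eq))) ⟩
  (+ (x ℤ.%ℕ d) ℤ.+ x ℤ./ℕ d ℤ.* + d) ℤ.- (+ (x ℤ.%ℕ d) ℤ.+ y ℤ./ℕ d ℤ.* + d)
    ≡⟨ cancel (+ (x ℤ.%ℕ d)) (x ℤ./ℕ d) (y ℤ./ℕ d) (+ d) ⟩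
  (x ℤ./ℕ d ℤ.- y ℤ./ℕ d) ℤ.* + d
    ∎)
  where
  open ≡-Reasoning
  cancel : ∀ r s t d → (r ℤ.+ s ℤ.* d) ℤ.- (r ℤ.+ t ℤ.* d) ≡ (s ℤ.- t) ℤ.* d
  cancel = solve-∀ ℤ-ring

powers-collide : ∀ v P .{{_ : NonZero P}} → ∃₂ λ i j → i ℕ.< j × + P ∣ v ℤ.^ j ℤ.- v ℤ.^ i
powers-collide v P with FinP.pigeonhole (ℕP.n<1+n P) (λ i → fromℕ< (ℤ.n%ℕd<d (v ℤ.^ toℕ i) P))
... | i , j , i<j , same = toℕ i , toℕ j , i<j , %ℕ-≡⇒∣- (v ℤ.^ toℕ j) (v ℤ.^ toℕ i) P (sym residues-≡)
  where
  residues-≡ : v ℤ.^ toℕ i ℤ.%ℕ P ≡ v ℤ.^ toℕ j ℤ.%ℕ P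
  residues-≡ = trans (sym (FinP.toℕ-fromℕ< (ℤ.n%ℕd<d (v ℤ.^ toℕ i) P)))
                     (trans (cong toℕ same) (FinP.toℕ-fromℕ< (ℤ.n%ℕd<d (v ℤ.^ toℕ j) P)))

-- Two of the powers v⁰, …, vᴾ agree modulo P, and the smaller one can be cancelled.
multiplicativeOrder-+ : ∀ {v P} .{{_ : NonZero P}} → Bézout v (+ P) → ∃ λ m → m > 0 × + P ∣ v ℤ.^ m ℤ.- 1ℤ
multiplicativeOrder-+ {v} {P} bz with powers-collide v P
... | i , j , i<j , P∣vʲ-vⁱ =
  j ℕ.∸ i , ℕP.m<n⇒0<n∸m i<j , bézout-cancel (bézout-^ˡ i bz) (subst (+ P ∣_) vʲ-vⁱ≡vⁱ[vᵈ-1] P∣vʲ-vⁱ)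
  where
  factor : ∀ x y → x ℤ.* y ℤ.- x ≡ x ℤ.* (y ℤ.- 1ℤ)
  factor = solve-∀ ℤ-ring
  vʲ-vⁱ≡vⁱ[vᵈ-1] : v ℤ.^ j ℤ.- v ℤ.^ i ≡ v ℤ.^ i ℤ.* (v ℤ.^ (j ℕ.∸ i) ℤ.- 1ℤ)
  vʲ-vⁱ≡vⁱ[vᵈ-1] = trans
    (cong (ℤ._- v ℤ.^ i) (trans (cong (v ℤ.^_) (sym (ℕP.m+[n∸m]≡n (ℕP.<⇒≤ i<j))))
                                (ℤP.^-distribˡ-+-* v i (j ℕ.∸ i))))
    (factor (v ℤ.^ i) (v ℤ.^ (j ℕ.∸ i)))

-- N = 0 occurs when two of the given points coincide; then v = ±1.
multiplicativeOrder : ∀ {v N} → Bézout v N → ∃ λ m → m > 0 × N ∣ v ℤ.^ m ℤ.- 1ℤ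
multiplicativeOrder {v} {+ zero}   bz = 2 , s≤s z≤n , divides 0ℤ (begin
  v ℤ.* (v ℤ.* 1ℤ) ℤ.- 1ℤ  ≡⟨ cong (λ z → v ℤ.* z ℤ.- 1ℤ) (ℤP.*-identityʳ v) ⟩
  v ℤ.* v ℤ.- 1ℤ           ≡⟨ cong (ℤ._- 1ℤ) (bézout[v,0]⇒v*v≡1 bz) ⟩
  0ℤ                       ≡⟨ ℤP.*-zeroˡ 0ℤ ⟨
  0ℤ ℤ.* 0ℤ                ∎)
  where open ≡-Reasoning
multiplicativeOrder {N = + suc p}  bz = multiplicativeOrder-+ bz
multiplicativeOrder {N = -[1+ p ]} bz =
  map₂ (map₂ (∣-trans m∣∣m∣)) (multiplicativeOrder-+ (bézout-sym (bézout-neg (bézout-sym bz))))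

-- Homogenisation

-- homMonic A B c = Bⁿ f(A/B) for the monic f of degree n with lower coefficients c.
homMonic : ℤ → ℤ → List ℤ → ℤ
homMonic A B []       = 1ℤ
homMonic A B (c ∷ cs) = c ℤ.* B ℤ.^ suc (length cs) ℤ.+ A ℤ.* homMonic A B cs

evalMonic-homMonic : ∀ {A B x} c → fromℤ B ℚ.* x ≡ fromℤ A →
  fromℤ B ^ length c ℚ.* evalMonic c x ≡ fromℤ (homMonic A B c)
evalMonic-homMonic []       _      = refl
evalMonic-homMonic {A} {B} {x} (c ∷ cs) Bx≡A = begin
  fromℤ B ^ suc n ℚ.* evalMonic (c ∷ cs) x
    ≡⟨ cong (fromℤ B ^ suc n ℚ.*_) (evalMonic-∷ c cs x) ⟩
  (fromℤ B ℚ.* fromℤ B ^ n) ℚ.* (fromℤ c ℚ.+ x ℚ.* evalMonic cs x)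
    ≡⟨ distribute (fromℤ B) (fromℤ B ^ n) (fromℤ c) x (evalMonic cs x) ⟩
  fromℤ c ℚ.* fromℤ B ^ suc n ℚ.+ (fromℤ B ℚ.* x) ℚ.* (fromℤ B ^ n ℚ.* evalMonic cs x)
    ≡⟨ cong (fromℤ c ℚ.* fromℤ B ^ suc n ℚ.+_) (cong₂ ℚ._*_ Bx≡A (evalMonic-homMonic cs Bx≡A)) ⟩
  fromℤ c ℚ.* fromℤ B ^ suc n ℚ.+ fromℤ A ℚ.* fromℤ (homMonic A B cs)
    ≡⟨ cong (λ u → fromℤ c ℚ.* u ℚ.+ fromℤ A ℚ.* fromℤ (homMonic A B cs)) (fromℤ-homo-^ B (suc n)) ⟨
  fromℤ c ℚ.* fromℤ (B ℤ.^ suc n) ℚ.+ fromℤ A ℚ.* fromℤ (homMonic A B cs)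
    ≡⟨ cong₂ ℚ._+_ (fromℤ-homo-* c (B ℤ.^ suc n)) (fromℤ-homo-* A (homMonic A B cs)) ⟨
  fromℤ (c ℤ.* B ℤ.^ suc n) ℚ.+ fromℤ (A ℤ.* homMonic A B cs)
    ≡⟨ fromℤ-homo-+ (c ℤ.* B ℤ.^ suc n) (A ℤ.* homMonic A B cs) ⟨
  fromℤ (homMonic A B (c ∷ cs))
    ∎
  where
  open ≡-Reasoning
  n = length cs
  distribute : ∀ b bⁿ c x f → (b ℚ.* bⁿ) ℚ.* (c ℚ.+ x ℚ.* f) ≡ c ℚ.* (b ℚ.* bⁿ) ℚ.+ (b ℚ.* x) ℚ.* (bⁿ ℚ.* f)
  distribute = solve-∀ ℚ-ring

bézout-homMonic : ∀ {A B} c → Bézout A B → Bézout (homMonic A B c) B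
bézout-homMonic {A} {B} []       _    = bézout-sym (bézout-1ʳ B)
bézout-homMonic {A} {B} (c ∷ cs) bzAB =
  bézout-+-∣ (∣n⇒∣m*n c (∣m⇒∣m*n (B ℤ.^ length cs) ∣-refl)) (bézout-*ˡ bzAB (bézout-homMonic cs bzAB))

homMonic-cross : ∀ A B A′ B′ c → (B′ ℤ.* A ℤ.- A′ ℤ.* B) ∣
  B′ ℤ.^ length c ℤ.* homMonic A B c ℤ.- B ℤ.^ length c ℤ.* homMonic A′ B′ c
homMonic-cross A B A′ B′ []       = divides 0ℤ (identity (B′ ℤ.* A ℤ.- A′ ℤ.* B))
  where
  identity : ∀ D → 1ℤ ℤ.* 1ℤ ℤ.- 1ℤ ℤ.* 1ℤ ≡ 0ℤ ℤ.* D
  identity = solve-∀ ℤ-ring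
homMonic-cross A B A′ B′ (c ∷ cs) =
  subst (D ∣_) (sym (regroup A B A′ B′ c (B′ ℤ.^ n) (B ℤ.^ n) H H′))
    (∣m∣n⇒∣m+n (∣n⇒∣m*n (B′ ℤ.* A) (homMonic-cross A B A′ B′ cs)) (∣n⇒∣m*n (B ℤ.^ n ℤ.* H′) ∣-refl))
  where
  n  = length cs
  D  = B′ ℤ.* A ℤ.- A′ ℤ.* B
  H  = homMonic A B cs
  H′ = homMonic A′ B′ cs
  regroup : ∀ A B A′ B′ c P′ P H H′ →
    (B′ ℤ.* P′) ℤ.* (c ℤ.* (B ℤ.* P) ℤ.+ A ℤ.* H) ℤ.- (B ℤ.* P) ℤ.* (c ℤ.* (B′ ℤ.* P′) ℤ.+ A′ ℤ.* H′)
      ≡ B′ ℤ.* A ℤ.* (P′ ℤ.* H ℤ.- P ℤ.* H′) ℤ.+ P ℤ.* H′ ℤ.* (B′ ℤ.* A ℤ.- A′ ℤ.* B)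
  regroup = solve-∀ ℤ-ring

-- Polynomials vanishing at the given points

mulLinear : ℤ → ℤ → List ℤ → List ℤ
mulLinear β α p = scale (ℤ.- α) p ⊕ (0ℤ ∷ scale β p)

eval-mulLinear : ∀ β α p x → ⟦ mulLinear β α p ⟧ x ≡ (fromℤ β ℚ.* x ℚ.- fromℤ α) ℚ.* ⟦ p ⟧ x
eval-mulLinear β α p x = begin
  ⟦ mulLinear β α p ⟧ x
    ≡⟨ eval-⊕ (scale (ℤ.- α) p) (0ℤ ∷ scale β p) x ⟩
  ⟦ scale (ℤ.- α) p ⟧ x ℚ.+ (ℚ.0ℚ ℚ.+ x ℚ.* ⟦ scale β p ⟧ x)
    ≡⟨ cong₂ (λ u v → u ℚ.+ (ℚ.0ℚ ℚ.+ x ℚ.* v))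
             (trans (eval-scale (ℤ.- α) p x) (cong (ℚ._* ⟦ p ⟧ x) (fromℤ-homo‿- α))) (eval-scale β p x) ⟩
  ℚ.- fromℤ α ℚ.* ⟦ p ⟧ x ℚ.+ (ℚ.0ℚ ℚ.+ x ℚ.* (fromℤ β ℚ.* ⟦ p ⟧ x))
    ≡⟨ factor (fromℤ α) (fromℤ β) x (⟦ p ⟧ x) ⟩
  (fromℤ β ℚ.* x ℚ.- fromℤ α) ℚ.* ⟦ p ⟧ x
    ∎
  where
  open ≡-Reasoning
  factor : ∀ a b x u → ℚ.- a ℚ.* u ℚ.+ (ℚ.0ℚ ℚ.+ x ℚ.* (b ℚ.* u)) ≡ (b ℚ.* x ℚ.- a) ℚ.* u
  factor = solve-∀ ℚ-ring

length-mulLinear : ∀ β α p → length (mulLinear β α p) ≡ suc (length p)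
length-mulLinear β α p = begin
  length (mulLinear β α p)
    ≡⟨ length-⊕ (scale (ℤ.- α) p) (0ℤ ∷ scale β p) ⟩
  length (scale (ℤ.- α) p) ℕ.⊔ suc (length (scale β p))
    ≡⟨ cong₂ (λ u v → u ℕ.⊔ suc v) (length-scale (ℤ.- α) p) (length-scale β p) ⟩
  length p ℕ.⊔ suc (length p)
    ≡⟨ ℕP.m≤n⇒m⊔n≡n (ℕP.n≤1+n (length p)) ⟩
  suc (length p)
    ∎
  where open ≡-Reasoning

mulVanishing : (k : ℕ) → (Fin k → ℤ) → (Fin k → ℕ) → List ℤ → List ℤ
mulVanishing zero    a b p = p
mulVanishing (suc k) a b p = mulLinear (+ b fzero) (a fzero) (mulVanishing k (a ∘ fsuc) (b ∘ fsuc) p)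

length-mulVanishing : ∀ k a b p → length (mulVanishing k a b p) ≡ k ℕ.+ length p
length-mulVanishing zero    a b p = refl
length-mulVanishing (suc k) a b p =
  trans (length-mulLinear (+ b fzero) (a fzero) (mulVanishing k (a ∘ fsuc) (b ∘ fsuc) p))
        (cong suc (length-mulVanishing k (a ∘ fsuc) (b ∘ fsuc) p))

mulVanishing-root : ∀ k a b p {x} j → fromℤ (+ b j) ℚ.* x ≡ fromℤ (a j) →
  ⟦ mulVanishing k a b p ⟧ x ≡ ℚ.0ℚ
mulVanishing-root (suc k) a b p {x} fzero bx≡a = begin
  ⟦ mulVanishing (suc k) a b p ⟧ x
    ≡⟨ eval-mulLinear (+ b fzero) (a fzero) (mulVanishing k (a ∘ fsuc) (b ∘ fsuc) p) x ⟩
  (fromℤ (+ b fzero) ℚ.* x ℚ.- fromℤ (a fzero)) ℚ.* rest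
    ≡⟨ cong (λ u → (u ℚ.- fromℤ (a fzero)) ℚ.* rest) bx≡a ⟩
  (fromℤ (a fzero) ℚ.- fromℤ (a fzero)) ℚ.* rest
    ≡⟨ cong (ℚ._* rest) (ℚP.+-inverseʳ (fromℤ (a fzero))) ⟩
  ℚ.0ℚ ℚ.* rest
    ≡⟨ ℚP.*-zeroˡ rest ⟩
  ℚ.0ℚ
    ∎
  where
  open ≡-Reasoning
  rest = ⟦ mulVanishing k (a ∘ fsuc) (b ∘ fsuc) p ⟧ x
mulVanishing-root (suc k) a b p {x} (fsuc j) bx≡a =
  trans (eval-mulLinear (+ b fzero) (a fzero) (mulVanishing k (a ∘ fsuc) (b ∘ fsuc) p) x)
        (trans (cong (factor ℚ.*_) (mulVanishing-root k (a ∘ fsuc) (b ∘ fsuc) p j bx≡a)) (ℚP.*-zeroʳ factor))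
  where
  factor = fromℤ (+ b fzero) ℚ.* x ℚ.- fromℤ (a fzero)

∏det : (k : ℕ) → (Fin k → ℤ) → (Fin k → ℕ) → ℤ → ℤ → ℤ
∏det zero    a b A B = 1ℤ
∏det (suc k) a b A B = (+ b fzero ℤ.* A ℤ.- a fzero ℤ.* B) ℤ.* ∏det k (a ∘ fsuc) (b ∘ fsuc) A B

mulVanishing-hom : ∀ k a b p {A B x} → fromℤ B ℚ.* x ≡ fromℤ A →
  fromℤ B ^ k ℚ.* ⟦ mulVanishing k a b p ⟧ x ≡ fromℤ (∏det k a b A B) ℚ.* ⟦ p ⟧ x
mulVanishing-hom zero    a b p Bx≡A = refl
mulVanishing-hom (suc k) a b p {A} {B} {x} Bx≡A = begin
  (fromℤ B ℚ.* fromℤ B ^ k) ℚ.* ⟦ mulLinear β α G ⟧ x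
    ≡⟨ cong (fromℤ B ℚ.* fromℤ B ^ k ℚ.*_) (eval-mulLinear β α G x) ⟩
  (fromℤ B ℚ.* fromℤ B ^ k) ℚ.* ((fromℤ β ℚ.* x ℚ.- fromℤ α) ℚ.* ⟦ G ⟧ x)
    ≡⟨ regroup (fromℤ B) (fromℤ B ^ k) (fromℤ β) x (fromℤ α) (⟦ G ⟧ x) ⟩
  (fromℤ β ℚ.* (fromℤ B ℚ.* x) ℚ.- fromℤ α ℚ.* fromℤ B) ℚ.* (fromℤ B ^ k ℚ.* ⟦ G ⟧ x)
    ≡⟨ cong₂ (λ u v → (fromℤ β ℚ.* u ℚ.- fromℤ α ℚ.* fromℤ B) ℚ.* v) Bx≡A
             (mulVanishing-hom k (a ∘ fsuc) (b ∘ fsuc) p Bx≡A) ⟩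
  (fromℤ β ℚ.* fromℤ A ℚ.- fromℤ α ℚ.* fromℤ B) ℚ.* (fromℤ Π ℚ.* ⟦ p ⟧ x)
    ≡⟨ cong (ℚ._* (fromℤ Π ℚ.* ⟦ p ⟧ x)) fromℤ-det ⟨
  fromℤ (β ℤ.* A ℤ.- α ℤ.* B) ℚ.* (fromℤ Π ℚ.* ⟦ p ⟧ x)
    ≡⟨ ℚP.*-assoc (fromℤ (β ℤ.* A ℤ.- α ℤ.* B)) (fromℤ Π) (⟦ p ⟧ x) ⟨
  fromℤ (β ℤ.* A ℤ.- α ℤ.* B) ℚ.* fromℤ Π ℚ.* ⟦ p ⟧ x
    ≡⟨ cong (ℚ._* ⟦ p ⟧ x) (fromℤ-homo-* (β ℤ.* A ℤ.- α ℤ.* B) Π) ⟨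
  fromℤ (∏det (suc k) a b A B) ℚ.* ⟦ p ⟧ x
    ∎
  where
  open ≡-Reasoning
  β = + b fzero
  α = a fzero
  G = mulVanishing k (a ∘ fsuc) (b ∘ fsuc) p
  Π = ∏det k (a ∘ fsuc) (b ∘ fsuc) A B
  fromℤ-det : fromℤ (β ℤ.* A ℤ.- α ℤ.* B) ≡ fromℤ β ℚ.* fromℤ A ℚ.- fromℤ α ℚ.* fromℤ B
  fromℤ-det = trans (fromℤ-homo-− (β ℤ.* A) (α ℤ.* B))
                    (cong₂ ℚ._-_ (fromℤ-homo-* β A) (fromℤ-homo-* α B))
  regroup : ∀ b bᵏ β x α g → (b ℚ.* bᵏ) ℚ.* ((β ℚ.* x ℚ.- α) ℚ.* g)
                             ≡ (β ℚ.* (b ℚ.* x) ℚ.- α ℚ.* b) ℚ.* (bᵏ ℚ.* g)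
  regroup = solve-∀ ℚ-ring

bézout-∏det : ∀ {v} k a b A B → (∀ j → Bézout v (+ b j ℤ.* A ℤ.- a j ℤ.* B)) → Bézout v (∏det k a b A B)
bézout-∏det {v} zero    a b A B _  = bézout-1ʳ v
bézout-∏det     (suc k) a b A B bz = bézout-*ʳ (bz fzero) (bézout-∏det k (a ∘ fsuc) (b ∘ fsuc) A B (bz ∘ fsuc))

-- With u Aᵉ + w Bᵉ = 1, Bᵉ · z (w + u (A/B)ᵉ) = z.
hitting : ∀ {A B} → Bézout A B → ℕ → ℤ → List ℤ
hitting bz e z = (z ℤ.* w ∷ []) ⊕ shift e (z ℤ.* u ∷ [])
  where open Bézout (bézout-^ʳ e (bézout-^ˡ e bz))

length-hitting : ∀ {A B} (bz : Bézout A B) e z → length (hitting bz e z) ≡ suc e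
length-hitting bz e z = trans (length-⊕ (_ ∷ []) (shift e (_ ∷ [])))
  (cong (1 ℕ.⊔_) (trans (length-shift e (_ ∷ [])) (ℕP.+-comm e 1)))

hitting-value : ∀ {A B x} (bz : Bézout A B) e z → fromℤ B ℚ.* x ≡ fromℤ A →
  fromℤ B ^ e ℚ.* ⟦ hitting bz e z ⟧ x ≡ fromℤ z
hitting-value {A} {B} {x} bz e z Bx≡A = begin
  fromℤ B ^ e ℚ.* ⟦ hitting bz e z ⟧ x
    ≡⟨ cong (fromℤ B ^ e ℚ.*_) (trans (eval-⊕ (z ℤ.* w ∷ []) (shift e (z ℤ.* u ∷ [])) x)
                                      (cong (⟦ z ℤ.* w ∷ [] ⟧ x ℚ.+_) (eval-shift e (z ℤ.* u ∷ []) x))) ⟩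
  fromℤ B ^ e ℚ.* ((fromℤ (z ℤ.* w) ℚ.+ x ℚ.* ℚ.0ℚ) ℚ.+ x ^ e ℚ.* (fromℤ (z ℤ.* u) ℚ.+ x ℚ.* ℚ.0ℚ))
    ≡⟨ expand (fromℤ B ^ e) (fromℤ (z ℤ.* w)) x (x ^ e) (fromℤ (z ℤ.* u)) ⟩
  fromℤ (z ℤ.* w) ℚ.* fromℤ B ^ e ℚ.+ fromℤ (z ℤ.* u) ℚ.* (fromℤ B ^ e ℚ.* x ^ e)
    ≡⟨ cong (λ y → fromℤ (z ℤ.* w) ℚ.* fromℤ B ^ e ℚ.+ fromℤ (z ℤ.* u) ℚ.* y)
            (trans (sym (^-distribʳ-* (fromℤ B) x e)) (cong (_^ e) Bx≡A)) ⟩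
  fromℤ (z ℤ.* w) ℚ.* fromℤ B ^ e ℚ.+ fromℤ (z ℤ.* u) ℚ.* fromℤ A ^ e
    ≡⟨ cong₂ (λ y y′ → fromℤ (z ℤ.* w) ℚ.* y ℚ.+ fromℤ (z ℤ.* u) ℚ.* y′)
             (fromℤ-homo-^ B e) (fromℤ-homo-^ A e) ⟨
  fromℤ (z ℤ.* w) ℚ.* fromℤ (B ℤ.^ e) ℚ.+ fromℤ (z ℤ.* u) ℚ.* fromℤ (A ℤ.^ e)
    ≡⟨ cong₂ ℚ._+_ (fromℤ-homo-* (z ℤ.* w) (B ℤ.^ e)) (fromℤ-homo-* (z ℤ.* u) (A ℤ.^ e)) ⟨
  fromℤ (z ℤ.* w ℤ.* B ℤ.^ e) ℚ.+ fromℤ (z ℤ.* u ℤ.* A ℤ.^ e)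
    ≡⟨ fromℤ-homo-+ (z ℤ.* w ℤ.* B ℤ.^ e) (z ℤ.* u ℤ.* A ℤ.^ e) ⟨
  fromℤ (z ℤ.* w ℤ.* B ℤ.^ e ℤ.+ z ℤ.* u ℤ.* A ℤ.^ e)
    ≡⟨ cong fromℤ (trans (factor z u w (A ℤ.^ e) (B ℤ.^ e)) (trans (cong (z ℤ.*_) identity) (ℤP.*-identityʳ z))) ⟩
  fromℤ z
    ∎
  where
  open ≡-Reasoning
  open Bézout (bézout-^ʳ e (bézout-^ˡ e bz))
  expand : ∀ bᵉ zw x xᵉ zu → bᵉ ℚ.* ((zw ℚ.+ x ℚ.* ℚ.0ℚ) ℚ.+ xᵉ ℚ.* (zu ℚ.+ x ℚ.* ℚ.0ℚ))
                            ≡ zw ℚ.* bᵉ ℚ.+ zu ℚ.* (bᵉ ℚ.* xᵉ)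
  expand = solve-∀ ℚ-ring
  factor : ∀ z u w aᵉ bᵉ → z ℤ.* w ℤ.* bᵉ ℤ.+ z ℤ.* u ℤ.* aᵉ ≡ z ℤ.* (u ℤ.* aᵉ ℤ.+ w ℤ.* bᵉ)
  factor = solve-∀ ℤ-ring

-- The induction step

homMonic-^ₘ-⊕ : ∀ {A B x} c M q → length q ℕ.≤ M ℕ.* length c → fromℤ B ℚ.* x ≡ fromℤ A →
  fromℤ (homMonic A B (c ^ₘ M ⊕ q)) ≡ fromℤ (homMonic A B c ℤ.^ M) ℚ.+ fromℤ B ^ (M ℕ.* length c) ℚ.* ⟦ q ⟧ x
homMonic-^ₘ-⊕ {A} {B} {x} c M q q≤ Bx≡A = begin
  fromℤ (homMonic A B (c ^ₘ M ⊕ q))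
    ≡⟨ evalMonic-homMonic (c ^ₘ M ⊕ q) Bx≡A ⟨
  fromℤ B ^ length (c ^ₘ M ⊕ q) ℚ.* evalMonic (c ^ₘ M ⊕ q) x
    ≡⟨ cong₂ (λ l y → fromℤ B ^ l ℚ.* y) (trans (length-⊕-≤ (c ^ₘ M) q q≤′) (length-^ₘ c M))
             (trans (evalMonic-⊕-≤ (c ^ₘ M) q x q≤′) (cong (ℚ._+ ⟦ q ⟧ x) (evalMonic-^ₘ c M x))) ⟩
  fromℤ B ^ (M ℕ.* n) ℚ.* (evalMonic c x ^ M ℚ.+ ⟦ q ⟧ x)
    ≡⟨ ℚP.*-distribˡ-+ (fromℤ B ^ (M ℕ.* n)) (evalMonic c x ^ M) (⟦ q ⟧ x) ⟩
  fromℤ B ^ (M ℕ.* n) ℚ.* evalMonic c x ^ M ℚ.+ fromℤ B ^ (M ℕ.* n) ℚ.* ⟦ q ⟧ x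
    ≡⟨ cong (ℚ._+ fromℤ B ^ (M ℕ.* n) ℚ.* ⟦ q ⟧ x) scaled-power ⟩
  fromℤ (homMonic A B c ℤ.^ M) ℚ.+ fromℤ B ^ (M ℕ.* n) ℚ.* ⟦ q ⟧ x
    ∎
  where
  open ≡-Reasoning
  n = length c
  q≤′ : length q ℕ.≤ length (c ^ₘ M)
  q≤′ = subst (length q ℕ.≤_) (sym (length-^ₘ c M)) q≤
  scaled-power : fromℤ B ^ (M ℕ.* n) ℚ.* evalMonic c x ^ M ≡ fromℤ (homMonic A B c ℤ.^ M)
  scaled-power = begin
    fromℤ B ^ (M ℕ.* n) ℚ.* evalMonic c x ^ M   ≡⟨ cong (λ l → fromℤ B ^ l ℚ.* evalMonic c x ^ M) (ℕP.*-comm M n) ⟩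
    fromℤ B ^ (n ℕ.* M) ℚ.* evalMonic c x ^ M   ≡⟨ cong (ℚ._* evalMonic c x ^ M) (^-*-assoc (fromℤ B) n M) ⟨
    (fromℤ B ^ n) ^ M ℚ.* evalMonic c x ^ M     ≡⟨ ^-distribʳ-* (fromℤ B ^ n) (evalMonic c x) M ⟨
    (fromℤ B ^ n ℚ.* evalMonic c x) ^ M         ≡⟨ cong (_^ M) (evalMonic-homMonic c Bx≡A) ⟩
    fromℤ (homMonic A B c) ^ M                  ≡⟨ fromℤ-homo-^ (homMonic A B c) M ⟨
    fromℤ (homMonic A B c ℤ.^ M)                ∎

homMonic-^ₘ-⊕-root : ∀ {A B x} c M q → length q ℕ.≤ M ℕ.* length c → fromℤ B ℚ.* x ≡ fromℤ A →
  homMonic A B c ≡ 1ℤ → ⟦ q ⟧ x ≡ ℚ.0ℚ → homMonic A B (c ^ₘ M ⊕ q) ≡ 1ℤ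
homMonic-^ₘ-⊕-root {A} {B} {x} c M q q≤ Bx≡A H≡1 q[x]≡0 = fromℤ-injective (begin
  fromℤ (homMonic A B (c ^ₘ M ⊕ q))
    ≡⟨ homMonic-^ₘ-⊕ c M q q≤ Bx≡A ⟩
  fromℤ (homMonic A B c ℤ.^ M) ℚ.+ fromℤ B ^ (M ℕ.* length c) ℚ.* ⟦ q ⟧ x
    ≡⟨ cong₂ (λ h y → fromℤ (h ℤ.^ M) ℚ.+ fromℤ B ^ (M ℕ.* length c) ℚ.* y) H≡1 q[x]≡0 ⟩
  fromℤ (1ℤ ℤ.^ M) ℚ.+ fromℤ B ^ (M ℕ.* length c) ℚ.* ℚ.0ℚ
    ≡⟨ cong₂ ℚ._+_ (cong fromℤ (ℤP.^-zeroˡ M)) (ℚP.*-zeroʳ (fromℤ B ^ (M ℕ.* length c))) ⟩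
  ℚ.1ℚ ℚ.+ ℚ.0ℚ
    ≡⟨ ℚP.+-identityʳ ℚ.1ℚ ⟩
  fromℤ 1ℤ
    ∎)
  where open ≡-Reasoning

-- v = Bⁿ f(A/B) ≡ Aⁿ modulo B, and bⱼⁿ v ≡ Bⁿ modulo bⱼA − aⱼB because bⱼⁿ f(aⱼ/bⱼ) = 1.
bézout-homMonic-∏det : ∀ k a b {A B} c → Bézout A B → (∀ j → homMonic (a j) (+ b j) c ≡ 1ℤ) →
  Bézout (homMonic A B c) (∏det k a b A B ℤ.* B)
bézout-homMonic-∏det k a b {A} {B} c bzAB old =
  bézout-*ʳ (bézout-∏det k a b A B (λ j → bézout-transfer ((+ b j) ℤ.^ n) (cross j) (bézout-^ʳ n bzvB))) bzvB
  where
  n = length c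
  bzvB = bézout-homMonic c bzAB
  cross : ∀ j → (+ b j ℤ.* A ℤ.- a j ℤ.* B) ∣ (+ b j) ℤ.^ n ℤ.* homMonic A B c ℤ.- B ℤ.^ n
  cross j = subst (λ h → _ ∣ (+ b j) ℤ.^ n ℤ.* homMonic A B c ℤ.- h)
    (trans (cong (B ℤ.^ n ℤ.*_) (old j)) (ℤP.*-identityʳ (B ℤ.^ n))) (homMonic-cross A B (a j) (+ b j) c)

mulVanishing-hitting-value : ∀ k a b {A B x} (bz : Bézout A B) e z → fromℤ B ℚ.* x ≡ fromℤ A →
  fromℤ B ^ (k ℕ.+ suc e) ℚ.* ⟦ mulVanishing k a b (hitting bz e z) ⟧ x ≡ fromℤ (∏det k a b A B ℤ.* (z ℤ.* B))
mulVanishing-hitting-value k a b {A} {B} {x} bz e z Bx≡A = begin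
  fromℤ B ^ (k ℕ.+ suc e) ℚ.* ⟦ mulVanishing k a b h ⟧ x
    ≡⟨ cong (ℚ._* ⟦ mulVanishing k a b h ⟧ x) (^-distribˡ-+-* (fromℤ B) k (suc e)) ⟩
  (fromℤ B ^ k ℚ.* (fromℤ B ℚ.* fromℤ B ^ e)) ℚ.* ⟦ mulVanishing k a b h ⟧ x
    ≡⟨ regroup (fromℤ B ^ k) (fromℤ B) (fromℤ B ^ e) (⟦ mulVanishing k a b h ⟧ x) ⟩
  (fromℤ B ℚ.* fromℤ B ^ e) ℚ.* (fromℤ B ^ k ℚ.* ⟦ mulVanishing k a b h ⟧ x)
    ≡⟨ cong (fromℤ B ℚ.* fromℤ B ^ e ℚ.*_) (mulVanishing-hom k a b h {A} {B} {x} Bx≡A) ⟩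
  (fromℤ B ℚ.* fromℤ B ^ e) ℚ.* (fromℤ Π ℚ.* ⟦ h ⟧ x)
    ≡⟨ regroup′ (fromℤ B) (fromℤ B ^ e) (fromℤ Π) (⟦ h ⟧ x) ⟩
  fromℤ Π ℚ.* (fromℤ B ^ e ℚ.* ⟦ h ⟧ x ℚ.* fromℤ B)
    ≡⟨ cong (λ y → fromℤ Π ℚ.* (y ℚ.* fromℤ B)) (hitting-value bz e z Bx≡A) ⟩
  fromℤ Π ℚ.* (fromℤ z ℚ.* fromℤ B)
    ≡⟨ trans (fromℤ-homo-* Π (z ℤ.* B)) (cong (fromℤ Π ℚ.*_) (fromℤ-homo-* z B)) ⟨
  fromℤ (Π ℤ.* (z ℤ.* B))
    ∎
  where
  open ≡-Reasoning
  h = hitting bz e z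
  Π = ∏det k a b A B
  regroup : ∀ bᵏ b bᵉ g → (bᵏ ℚ.* (b ℚ.* bᵉ)) ℚ.* g ≡ (b ℚ.* bᵉ) ℚ.* (bᵏ ℚ.* g)
  regroup = solve-∀ ℚ-ring
  regroup′ : ∀ b bᵉ π g → (b ℚ.* bᵉ) ℚ.* (π ℚ.* g) ≡ π ℚ.* (bᵉ ℚ.* g ℚ.* b)
  regroup′ = solve-∀ ℚ-ring

IntegralInterpolant : (k : ℕ) → (Fin k → ℤ) → (Fin k → ℕ) → Set
IntegralInterpolant k a b = Σ (List ℤ) λ c → length c > 0 × ∀ i → homMonic (a i) (+ b i) c ≡ 1ℤ

x+g*[-s*b]≡1 : ∀ {x g b} s → x ℤ.- 1ℤ ≡ s ℤ.* (g ℤ.* b) → x ℤ.+ g ℤ.* (ℤ.- s ℤ.* b) ≡ 1ℤ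
x+g*[-s*b]≡1 {x} {g} {b} s eq = trans (expand x g s b)
  (trans (cong (λ y → y ℤ.- s ℤ.* (g ℤ.* b) ℤ.+ 1ℤ) eq) (cancel (s ℤ.* (g ℤ.* b))))
  where
  expand : ∀ x g s b → x ℤ.+ g ℤ.* (ℤ.- s ℤ.* b) ≡ (x ℤ.- 1ℤ) ℤ.- s ℤ.* (g ℤ.* b) ℤ.+ 1ℤ
  expand = solve-∀ ℤ-ring
  cancel : ∀ y → y ℤ.- y ℤ.+ 1ℤ ≡ 1ℤ
  cancel = solve-∀ ℤ-ring

extendBy : ∀ k (a : Fin (suc k) → ℤ) (b : Fin (suc k) → ℕ) (b>0 : ∀ i → NonZero (b i))
  (bzAB : Bézout (a fzero) (+ b fzero)) c → (∀ j → homMonic (a (fsuc j)) (+ b (fsuc j)) c ≡ 1ℤ) →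
  ∀ M → suc k ℕ.≤ M ℕ.* length c →
  ∏det k (a ∘ fsuc) (b ∘ fsuc) (a fzero) (+ b fzero) ℤ.* + b fzero ∣ homMonic (a fzero) (+ b fzero) c ℤ.^ M ℤ.- 1ℤ →
  IntegralInterpolant (suc k) a b
extendBy k a b b>0 bzAB c old M k<N GB∣vᴹ-1 = c ^ₘ M ⊕ q , length>0 , values
  where
  A = a fzero
  B = + b fzero
  r = ℚ._/_ A (b fzero) {{b>0 fzero}}
  v = homMonic A B c
  G = ∏det k (a ∘ fsuc) (b ∘ fsuc) A B
  N = M ℕ.* length c
  e = N ℕ.∸ suc k
  k+[1+e]≡N : k ℕ.+ suc e ≡ N
  k+[1+e]≡N = trans (ℕP.+-suc k e) (ℕP.m+[n∸m]≡n k<N)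
  s = _∣_.quotient GB∣vᴹ-1
  q = mulVanishing k (a ∘ fsuc) (b ∘ fsuc) (hitting bzAB e (ℤ.- s))
  length-q : length q ≡ N
  length-q = trans (length-mulVanishing k (a ∘ fsuc) (b ∘ fsuc) (hitting bzAB e (ℤ.- s)))
                   (trans (cong (k ℕ.+_) (length-hitting bzAB e (ℤ.- s))) k+[1+e]≡N)
  q≤N : length q ℕ.≤ N
  q≤N = ℕP.≤-reflexive length-q
  length>0 : length (c ^ₘ M ⊕ q) > 0
  length>0 = begin
    1                              ≤⟨ s≤s z≤n ⟩
    suc k                          ≤⟨ k<N ⟩
    N                              ≡⟨ length-q ⟨
    length q                       ≤⟨ ℕP.m≤n⊔m (length (c ^ₘ M)) (length q) ⟩
    length (c ^ₘ M) ℕ.⊔ length q   ≡⟨ length-⊕ (c ^ₘ M) q ⟨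
    length (c ^ₘ M ⊕ q)            ∎
    where open ℕP.≤-Reasoning
  point : ∀ i → fromℤ (+ b i) ℚ.* ℚ._/_ (a i) (b i) {{b>0 i}} ≡ fromℤ (a i)
  point i = fromℤ-*-/ (a i) (b i) {{b>0 i}}
  values : ∀ i → homMonic (a i) (+ b i) (c ^ₘ M ⊕ q) ≡ 1ℤ
  values fzero = fromℤ-injective (begin
    fromℤ (homMonic A B (c ^ₘ M ⊕ q))
      ≡⟨ homMonic-^ₘ-⊕ c M q q≤N (point fzero) ⟩
    fromℤ (v ℤ.^ M) ℚ.+ fromℤ B ^ N ℚ.* ⟦ q ⟧ r
      ≡⟨ cong (λ l → fromℤ (v ℤ.^ M) ℚ.+ fromℤ B ^ l ℚ.* ⟦ q ⟧ r) k+[1+e]≡N ⟨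
    fromℤ (v ℤ.^ M) ℚ.+ fromℤ B ^ (k ℕ.+ suc e) ℚ.* ⟦ q ⟧ r
      ≡⟨ cong (fromℤ (v ℤ.^ M) ℚ.+_)
              (mulVanishing-hitting-value k (a ∘ fsuc) (b ∘ fsuc) bzAB e (ℤ.- s) (point fzero)) ⟩
    fromℤ (v ℤ.^ M) ℚ.+ fromℤ (G ℤ.* (ℤ.- s ℤ.* B))
      ≡⟨ fromℤ-homo-+ (v ℤ.^ M) (G ℤ.* (ℤ.- s ℤ.* B)) ⟨
    fromℤ (v ℤ.^ M ℤ.+ G ℤ.* (ℤ.- s ℤ.* B))
      ≡⟨ cong fromℤ (x+g*[-s*b]≡1 {v ℤ.^ M} {G} {B} s (_∣_.equality GB∣vᴹ-1)) ⟩
    fromℤ 1ℤ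
      ∎)
    where open ≡-Reasoning
  values (fsuc j) = homMonic-^ₘ-⊕-root c M q q≤N (point (fsuc j)) (old j)
    (mulVanishing-root k (a ∘ fsuc) (b ∘ fsuc) _ j (point (fsuc j)))

extend : ∀ k (a : Fin (suc k) → ℤ) (b : Fin (suc k) → ℕ) → (∀ i → NonZero (b i)) →
  Bézout (a fzero) (+ b fzero) → IntegralInterpolant k (a ∘ fsuc) (b ∘ fsuc) → IntegralInterpolant (suc k) a b
extend k a b b>0 bzAB (c , n>0 , old) =
  extendWithOrder (multiplicativeOrder (bézout-homMonic-∏det k (a ∘ fsuc) (b ∘ fsuc) c bzAB old))
  where
  v = homMonic (a fzero) (+ b fzero) c
  GB = ∏det k (a ∘ fsuc) (b ∘ fsuc) (a fzero) (+ b fzero) ℤ.* + b fzero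
  extendWithOrder : (∃ λ m → m > 0 × GB ∣ v ℤ.^ m ℤ.- 1ℤ) → IntegralInterpolant (suc k) a b
  extendWithOrder (m , m>0 , GB∣vᵐ-1) = extendBy k a b b>0 bzAB c old M
    (ℕP.≤-trans (ℕP.m≤n*m (suc k) m {{ℕ.>-nonZero m>0}}) (ℕP.m≤m*n M (length c) {{ℕ.>-nonZero n>0}}))
    (subst (λ y → GB ∣ y ℤ.- 1ℤ) (ℤP.^-*-assoc v m (suc k)) (∣x-1⇒∣x^n-1 {x = v ℤ.^ m} (suc k) GB∣vᵐ-1))
    where M = m ℕ.* suc k

integralInterpolant : ∀ k (a : Fin k → ℤ) (b : Fin k → ℕ) → (∀ i → NonZero (b i)) →
  (∀ i → Bézout (a i) (+ b i)) → IntegralInterpolant k a b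
integralInterpolant zero    a b b>0 bz = 0ℤ ∷ [] , s≤s z≤n , λ ()
integralInterpolant (suc k) a b b>0 bz =
  extend k a b b>0 (bz fzero) (integralInterpolant k (a ∘ fsuc) (b ∘ fsuc) (b>0 ∘ fsuc) (bz ∘ fsuc))

homMonic≡1⇒evalMonic≡1/ : ∀ a b .{{_ : NonZero b}} c → homMonic a (+ b) c ≡ 1ℤ →
  evalMonic c (a ℚ./ b) ≡ ℚ._/_ 1ℤ (b ℕ.^ length c) {{m^n≢0 b (length c)}}
homMonic≡1⇒evalMonic≡1/ a b c H≡1 = fromℤ-*≡1⇒≡1/ (b ℕ.^ length c) {{m^n≢0 b (length c)}} (evalMonic c (a ℚ./ b))
  (trans (cong (ℚ._* evalMonic c (a ℚ./ b)) (fromℤ-+-^ b (length c)))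
         (trans (evalMonic-homMonic c (fromℤ-*-/ a b)) (cong fromℤ H≡1)))

theorem2p1 : (k : ℕ) (a : Fin k → ℤ) (b : Fin k → ℕ)
    → (b>0 : ∀ i → NonZero (b i))
    → (∀ i → gcd (a i) (ℤ.+ b i) ≡ ℤ.1ℤ)
    → Σ ℕ λ n → n > 0 × Σ (List ℤ) λ c → length c ≡ n ×
        (∀ i → evalMonic c (ℚ._/_ (a i) (b i) {{b>0 i}}) ≡ ℚ._/_ ℤ.1ℤ (b i ℕ.^ n) {{m^n≢0 (b i) n {{b>0 i}}}})
theorem2p1 k a b b>0 coprime
  with integralInterpolant k a b b>0 (λ i → gcd≡1⇒bézout (a i) (b i) (coprime i))
... | c , n>0 , values =
  length c , n>0 , c , refl , λ i → homMonic≡1⇒evalMonic≡1/ (a i) (b i) {{b>0 i}} c (values i)
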